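{- Let $\mathcal{X}$ be a regular $3$-premaniplex such that $\mathcal{X}_{\overline{2}}$ is a polygon and $\mathcal{X}_{\overline{0}}$ is connected. Then $\mathcal{X}$ is isomorphic to either a member of family 1, a member of family 2, or the premaniplex $\mathcal{X}_s$.
   Context: Graphs are allowed to have semi-edges and parallel edges: a graph consists of vertices, darts, an initial-vertex map and an involution $d\mapsto d^{ -1}$ on darts; an edge is a set $\{d,d^{ -1}\}$, and a semi-edge is a dart with $d=d^{ -1}$. An $n$-premaniplex is a connected graph whose edges are colored with colors in $\{0,\dots,n-1\}$ so that every vertex (called a flag) is incident to exactly one edge of each color, and for $|i-j|>1$ every alternating path of length 4 with colors $i,j$ is closed. For a flag $\Phi$, $r_i\Phi$ denotes the flag joined to $\Phi$ by the edge of color $i$. An isomorphism of premaniplexes is a color-preserving graph isomorphism; a premaniplex is regular if its automorphism group acts transitively on its flags. $\mathcal{X}_{\overline{i}}$ denotes the graph obtained from $\mathcal{X}$ by deleting all edges of color $i$. A polygon ($n$-gon, $n\ge 2$) is a 2-premaniplex whose $2n$ flags form a single cycle alternating colors $0$ and $1$ (with no semi-edges). Family 1: for $n\ge 2$, the 3-premaniplex obtained from an $n$-gon by adding, for each edge of color 0, an edge of color 2 joining the same two flags. Family 2: for $n=4k$, $k\ge1$, the 3-premaniplex obtained from an $n$-gon by adding an edge of color 2 joining each flag $\Phi$ to the flag $r_0(r_1r_0)^{n/2}\Phi$ (computed in the $n$-gon). $\mathcal{X}_s$: the 3-premaniplex obtained from a 2-gon (4 flags) by adding an edge of color 2 joining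 each flag $\Phi$ to $r_1r_0\Phi$ (the opposite flag). -}

module Defs where

open import Data.Nat using (ℕ; zero; suc; _+_; _*_; _<_; ∣_-_∣; NonZero)
open import Data.Nat.Properties using (+-suc; +-comm)
open import Data.Nat.DivMod using (_%_; m%n<n; [m+n]%n≡m%n; m<n⇒m%n≡m; %-distribˡ-+; m%n%n≡m%n)
open import Data.Fin using (Fin; zero; suc; toℕ; fromℕ<; inject₁)
open import Data.Fin.Properties using (toℕ-fromℕ<; toℕ-injective; toℕ<n)
open import Data.Bool using (Bool; true; false; not)
open import Data.Bool.Properties using (not-involutive)
open import Data.Product using (Σ; _×_; _,_; proj₁; proj₂)
open import Data.Sum using (_⊎_)
open import Relation.Binary.PropositionalEquality
open import Relation.Nullary using (¬_)

-- Graphs with darts (allowing semi-edges and parallel edges), whose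
-- edges are coloured with colours in Fin n.  A dart d with inv d ≡ d is
-- a semi-edge; an edge is the set {d , inv d}.

record ColouredGraph (n : ℕ) : Set₁ where
  field
    Vertex     : Set
    Dart       : Set
    initV      : Dart → Vertex
    inv        : Dart → Dart
    inv-inv    : ∀ d → inv (inv d) ≡ d
    colour     : Dart → Fin n
    colour-inv : ∀ d → colour (inv d) ≡ colour d

  termV : Dart → Vertex
  termV d = initV (inv d)

open ColouredGraph public

data Walk {n : ℕ} (G : ColouredGraph n) : Vertex G → Vertex G → Set where
  []   : ∀ {v} → Walk G v v
  step : ∀ {v w} (d : Dart G) → initV G d ≡ v → Walk G (termV G d) w → Walk G v w

Connected : ∀ {n} → ColouredGraph n → Set
Connected G = ∀ v w → Walk G v w

OneEdgeOfEachColour : ∀ {n} → ColouredGraph n → Set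
OneEdgeOfEachColour {n} G =
  ∀ (v : Vertex G) (i : Fin n) →
    Σ (Dart G) λ d → initV G d ≡ v × colour G d ≡ i ×
      (∀ d′ → initV G d′ ≡ v → colour G d′ ≡ i → d′ ≡ d ⊎ d′ ≡ inv G d)

AlternatingClosed : ∀ {n} → ColouredGraph n → Set
AlternatingClosed {n} G =
  ∀ (i j : Fin n) → 1 < ∣ toℕ i - toℕ j ∣ →
  ∀ d₁ d₂ d₃ d₄ →
    colour G d₁ ≡ i → colour G d₂ ≡ j → colour G d₃ ≡ i → colour G d₄ ≡ j →
    termV G d₁ ≡ initV G d₂ → termV G d₂ ≡ initV G d₃ → termV G d₃ ≡ initV G d₄ →
    termV G d₄ ≡ initV G d₁

-- n-premaniplex (the flags are the vertices)
IsPremaniplex : ∀ {n} → ColouredGraph n → Set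
IsPremaniplex G = Connected G × OneEdgeOfEachColour G × AlternatingClosed G

record Iso {n : ℕ} (G H : ColouredGraph n) : Set where
  field
    fV : Vertex G → Vertex H
    gV : Vertex H → Vertex G
    fD : Dart G → Dart H
    gD : Dart H → Dart G
    gfV : ∀ v → gV (fV v) ≡ v
    fgV : ∀ v → fV (gV v) ≡ v
    gfD : ∀ d → gD (fD d) ≡ d
    fgD : ∀ d → fD (gD d) ≡ d
    init-comm   : ∀ d → initV H (fD d) ≡ fV (initV G d)
    inv-comm    : ∀ d → inv H (fD d) ≡ fD (inv G d)
    colour-comm : ∀ d → colour H (fD d) ≡ colour G d

IsRegular : ∀ {n} → ColouredGraph n → Set
IsRegular G = ∀ Φ Ψ → Σ (Iso G G) λ α → Iso.fV α Φ ≡ Ψ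

record KeptDart {n : ℕ} (G : ColouredGraph n) (i : Fin n) : Set where
  constructor kept
  field
    dart     : Dart G
    .notDel  : ¬ (colour G dart ≡ i)

open KeptDart public

kept-≡ : ∀ {n} {G : ColouredGraph n} {i : Fin n} {x y : Dart G}
         .{p : ¬ (colour G x ≡ i)} .{q : ¬ (colour G y ≡ i)} →
         x ≡ y → kept {G = G} {i = i} x p ≡ kept y q
kept-≡ refl = refl

deleteColour : ∀ {n} → Fin n → ColouredGraph n → ColouredGraph n
deleteColour {n} i G = record
  { Vertex     = Vertex G
  ; Dart       = KeptDart G i
  ; initV      = λ d → initV G (dart d)
  ; inv        = λ { (kept d p) → kept (inv G d)
                         (λ e → p (trans (sym (colour-inv G d)) e)) }
  ; inv-inv    = λ { (kept d p) → kept-≡ (inv-inv G d) }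
  ; colour     = λ d → colour G (dart d)
  ; colour-inv = λ d → colour-inv G (dart d)
  }

-- Graphs given by involutions on flags (no loops; fixed points of the
-- involutions are semi-edges).  Colours m ⊆ Fin n via an embedding.

record Involutions (F : Set) (m : ℕ) : Set where
  field
    r     : Fin m → F → F
    r-inv : ∀ i Φ → r i (r i Φ) ≡ Φ

fromInvolutions : ∀ {m n} (emb : Fin m → Fin n) (F : Set) → Involutions F m → ColouredGraph n
fromInvolutions emb F R = record
  { Vertex     = F
  ; Dart       = F × Fin _
  ; initV      = proj₁
  ; inv        = λ { (Φ , i) → (Involutions.r R i Φ , i) }
  ; inv-inv    = λ { (Φ , i) → cong (_, i) (Involutions.r-inv R i Φ) }
  ; colour     = λ d → emb (proj₂ d)
  ; colour-inv = λ _ → refl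
  }

-- Flags are pairs (k , b) with k : Fin n, b : Bool; the flag
-- (k , false) is position 2k and (k , true) is position 2k+1 on a cycle of
-- length 2n.  Colour-0 edges join 2k and 2k+1; colour-1 edges join 2k+1
-- and 2k+2 (mod 2n).

sucMod : ∀ {m} → Fin (suc m) → Fin (suc m)
sucMod {m} k = fromℕ< (m%n<n (suc (toℕ k)) (suc m))

predMod : ∀ {m} → Fin (suc m) → Fin (suc m)
predMod {m} k = fromℕ< (m%n<n (toℕ k + m) (suc m))

predMod-sucMod : ∀ {m} (k : Fin (suc m)) → predMod (sucMod k) ≡ k
predMod-sucMod {m} k = toℕ-injective (begin
    toℕ (predMod (sucMod k))
  ≡⟨ toℕ-fromℕ< (m%n<n (toℕ (sucMod k) + m) (suc m)) ⟩
    (toℕ (sucMod k) + m) % suc m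
  ≡⟨ cong (λ x → (x + m) % suc m) (toℕ-fromℕ< (m%n<n (suc (toℕ k)) (suc m))) ⟩
    (suc (toℕ k) % suc m + m) % suc m
  ≡⟨ cong (λ x → (suc (toℕ k) % suc m + x) % suc m) (sym (m<n⇒m%n≡m {n = suc m} ≤-refl′)) ⟩
    (suc (toℕ k) % suc m + m % suc m) % suc m
  ≡⟨ sym (%-distribˡ-+ (suc (toℕ k)) m (suc m)) ⟩
    (suc (toℕ k) + m) % suc m
  ≡⟨ cong (_% suc m) (sym (+-suc (toℕ k) m)) ⟩
    (toℕ k + suc m) % suc m
  ≡⟨ [m+n]%n≡m%n (toℕ k) (suc m) ⟩
    toℕ k % suc m
  ≡⟨ m<n⇒m%n≡m (toℕ<n k) ⟩
    toℕ k ∎)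
  where
  open ≡-Reasoning
  ≤-refl′ : m < suc m
  ≤-refl′ = Data.Nat.Properties.n<1+n m
    where import Data.Nat.Properties

sucMod-predMod : ∀ {m} (k : Fin (suc m)) → sucMod (predMod k) ≡ k
sucMod-predMod {m} k = toℕ-injective (begin
    toℕ (sucMod (predMod k))
  ≡⟨ toℕ-fromℕ< (m%n<n (suc (toℕ (predMod k))) (suc m)) ⟩
    suc (toℕ (predMod k)) % suc m
  ≡⟨ cong (λ x → suc x % suc m) (toℕ-fromℕ< (m%n<n (toℕ k + m) (suc m))) ⟩
    (1 + (toℕ k + m) % suc m) % suc m
  ≡⟨ %-distribˡ-+ 1 ((toℕ k + m) % suc m) (suc m) ⟩
    (1 % suc m + (toℕ k + m) % suc m % suc m) % suc m
  ≡⟨ cong (λ x → (1 % suc m + x) % suc m) (m%n%n≡m%n (toℕ k + m) (suc m)) ⟩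
    (1 % suc m + (toℕ k + m) % suc m) % suc m
  ≡⟨ sym (%-distribˡ-+ 1 (toℕ k + m) (suc m)) ⟩
    (1 + (toℕ k + m)) % suc m
  ≡⟨ cong (_% suc m) (trans (+-comm 1 (toℕ k + m)) (trans (Data.Nat.Properties.+-assoc (toℕ k) m 1) (cong (toℕ k +_) (+-comm m 1)))) ⟩
    (toℕ k + suc m) % suc m
  ≡⟨ [m+n]%n≡m%n (toℕ k) (suc m) ⟩
    toℕ k % suc m
  ≡⟨ m<n⇒m%n≡m (toℕ<n k) ⟩
    toℕ k ∎)
  where
  open ≡-Reasoning
  import Data.Nat.Properties

PFlag : ℕ → Set
PFlag n = Fin n × Bool

pr0 : ∀ {n} → PFlag n → PFlag n
pr0 (k , b) = (k , not b)

pr1 : ∀ {n} → PFlag n → PFlag n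
pr1 {zero}  (() , _)
pr1 {suc m} (k , true)  = (sucMod k , false)
pr1 {suc m} (k , false) = (predMod k , true)

pr0-inv : ∀ {n} (Φ : PFlag n) → pr0 (pr0 Φ) ≡ Φ
pr0-inv (k , b) = cong (k ,_) (not-involutive b)

pr1-inv : ∀ {n} (Φ : PFlag n) → pr1 (pr1 Φ) ≡ Φ
pr1-inv {zero}  (() , _)
pr1-inv {suc m} (k , true)  = cong (_, true) (predMod-sucMod k)
pr1-inv {suc m} (k , false) = cong (_, false) (sucMod-predMod k)

polygonInvolutions : (n : ℕ) → Involutions (PFlag n) 2
polygonInvolutions n = record { r = r ; r-inv = r-inv }
  where
  r : Fin 2 → PFlag n → PFlag n
  r zero          = pr0
  r (suc zero)    = pr1
  r-inv : ∀ i Φ → r i (r i Φ) ≡ Φ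
  r-inv zero       = pr0-inv
  r-inv (suc zero) = pr1-inv

polygon : ℕ → ColouredGraph 3
polygon n = fromInvolutions inject₁ (PFlag n) (polygonInvolutions n)

iter : ∀ {A : Set} → (A → A) → ℕ → A → A
iter f zero    x = x
iter f (suc j) x = f (iter f j x)

threeFrom : (n : ℕ) (r₂ : PFlag n → PFlag n) → (∀ Φ → r₂ (r₂ Φ) ≡ Φ) → ColouredGraph 3
threeFrom n r₂ r₂-inv = fromInvolutions (λ i → i) (PFlag n) (record { r = r ; r-inv = r-inv })
  where
  r : Fin 3 → PFlag n → PFlag n
  r zero             = pr0
  r (suc zero)       = pr1
  r (suc (suc zero)) = r₂
  r-inv : ∀ i Φ → r i (r i Φ) ≡ Φ
  r-inv zero             = pr0-inv
  r-inv (suc zero)       = pr1-inv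
  r-inv (suc (suc zero)) = r₂-inv

-- Family 1: colour-2 edges parallel to the colour-0 edges
family1 : ℕ → ColouredGraph 3
family1 n = threeFrom n pr0 pr0-inv

module _ {n : ℕ} where
  w : ℕ → PFlag n → PFlag n
  w = iter (λ Φ → pr1 (pr0 Φ))

  v : ℕ → PFlag n → PFlag n
  v = iter (λ Φ → pr0 (pr1 Φ))

  iter-suc′ : ∀ {A : Set} (f : A → A) j x → iter f (suc j) x ≡ iter f j (f x)
  iter-suc′ f zero    x = refl
  iter-suc′ f (suc j) x = cong f (iter-suc′ f j x)

  conj : ∀ j x → pr0 (w j (pr0 x)) ≡ v j x
  conj zero    x = pr0-inv x
  conj (suc j) x = cong (λ y → pr0 (pr1 y)) (conj j x)

  cancel : ∀ j Φ → v j (w j Φ) ≡ Φ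
  cancel zero    Φ = refl
  cancel (suc j) Φ =
    trans (iter-suc′ (λ Φ → pr0 (pr1 Φ)) j (w (suc j) Φ))
      (trans (cong (v j) (trans (cong pr0 (pr1-inv (pr0 (w j Φ)))) (pr0-inv (w j Φ))))
             (cancel j Φ))

  reflect : ℕ → PFlag n → PFlag n
  reflect j Φ = pr0 (w j Φ)

  reflect-inv : ∀ j Φ → reflect j (reflect j Φ) ≡ Φ
  reflect-inv j Φ = trans (conj j (w j Φ)) (cancel j Φ)

-- Family 2 (n = 4k): colour-2 edge joins Φ to r₀ (r₁ r₀)^{n/2} Φ, n/2 = 2k
family2 : ℕ → ColouredGraph 3
family2 k = threeFrom (4 * k) (λ Φ → pr0 (iter (λ Ψ → pr1 (pr0 Ψ)) (2 * k) Φ))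
                              (reflect-inv (2 * k))

xs-inv : ∀ (Φ : PFlag 2) → pr1 (pr0 (pr1 (pr0 Φ))) ≡ Φ
xs-inv (zero , true)      = refl
xs-inv (zero , false)     = refl
xs-inv (suc zero , true)  = refl
xs-inv (suc zero , false) = refl

Xs : ColouredGraph 3
Xs = threeFrom 2 (λ Φ → pr1 (pr0 Φ)) xs-inv

-- Identify the flags of X with those of the polygon X₂̄ ≅ polygon n, so that r₀ and r₁ become
-- pr0 and pr1 and every automorphism of X becomes a map commuting with them. By regularity r₂
-- commutes with all such maps, so it is determined by its value on one flag: r₂ is a rotation
-- rot j or a reflection pr0 ∘ rot j with j < n, where rot is the rotation r₁r₀. Since r₂
-- (resp. r₂r₀) is an involution, n divides 2j, so j = 0 or n = 2j. Connectivity of X₀̄ makes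
-- ⟨r₁, r₂⟩ transitive on flags; but if r₂ lies in ⟨pr1, rot s⟩ and some d ≥ 2 divides both s and
-- n, the orbit of a flag under that group misses its 0-neighbour. This leaves only a reflection
-- with j = 0 (family 1), a reflection with n = 2j and j even (family 2), and the rotation with
-- j = 1 and n = 2 (X_s).
module Submission where

open import Defs
open import Data.Nat using (ℕ; zero; suc; _+_; _*_; _%_; _≤_; _<_; s≤s; z≤n; ∣_-_∣; NonZero)
open import Data.Nat.Properties
  using (+-identityʳ; *-identityʳ; *-suc; *-comm; m+n≡0⇒m≡0; +-mono-<; +-monoʳ-≤; m≤m+n; <-≤-trans; <-irrefl)
open import Data.Nat.DivMod using (m%n<n; m%n%n≡m%n; %-distribˡ-+; [m+kn]%n≡m%n; m<n⇒m%n≡m)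
open import Data.Nat.Divisibility
  using (_∣_; divides; _∣0; ∣-refl; ∣1⇒≡1; ∣m∣n⇒∣m+n; ∣n⇒∣m*n; %-presˡ-∣; ∣n∣m%n⇒∣m; m%n≡0⇒n∣m)
open import Data.Nat.Tactic.RingSolver using (solve-∀)
open import Data.Fin using (Fin; zero; suc; toℕ; fromℕ<; inject₁)
open import Data.Fin.Properties using (toℕ-fromℕ<; toℕ-injective; toℕ<n; inject₁-injective; fromℕ≢inject₁)
open import Data.Bool using (true; false; not)
open import Data.Bool.Properties using (not-involutive; not-¬)
open import Data.Product using (Σ; _×_; _,_; proj₁; proj₂)
open import Data.Sum using (_⊎_; inj₁; inj₂)
open import Data.Empty using (⊥; ⊥-elim)
import Data.Empty.Irrelevant as Irrelevant
open import Function using (_∘_; case_of_)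
open import Relation.Binary.PropositionalEquality
open import Relation.Nullary using (¬_)
import Algebra.Morphism.Definitions as MorphismDefinitions

module _ {A B : Set} where
  open MorphismDefinitions A B _≡_ public using (Homomorphic₁)

Iso-termV : ∀ {n} {G H : ColouredGraph n} (α : Iso G H) (d : Dart G) →
            Iso.fV α (termV G d) ≡ termV H (Iso.fD α d)
Iso-termV {G = G} {H} α d = sym (trans (cong (initV H) (Iso.inv-comm α d)) (Iso.init-comm α (inv G d)))

module Neighbours {n} (G : ColouredGraph n) (one : OneEdgeOfEachColour G) where

  dartAt : Vertex G → Fin n → Dart G
  dartAt v i = proj₁ (one v i)

  initV-dartAt : ∀ v i → initV G (dartAt v i) ≡ v
  initV-dartAt v i = proj₁ (proj₂ (one v i))

  colour-dartAt : ∀ v i → colour G (dartAt v i) ≡ i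
  colour-dartAt v i = proj₁ (proj₂ (proj₂ (one v i)))

  dartAt-unique : ∀ {v i} d → initV G d ≡ v → colour G d ≡ i → d ≡ dartAt v i ⊎ d ≡ inv G (dartAt v i)
  dartAt-unique {v} {i} = proj₂ (proj₂ (proj₂ (one v i)))

  r : Fin n → Vertex G → Vertex G
  r i v = termV G (dartAt v i)

  termV≡r : ∀ d → termV G d ≡ r (colour G d) (initV G d)
  termV≡r d with dartAt-unique d refl refl
  ... | inj₁ d≡D = cong (termV G) d≡D
  ... | inj₂ d≡D⁻¹ = begin
      termV G d                  ≡⟨ cong (termV G) d≡D⁻¹ ⟩
      initV G (inv G (inv G D))  ≡⟨ cong (initV G) (inv-inv G D) ⟩
      initV G D                  ≡⟨ initV-dartAt _ _ ⟩
      initV G d                  ≡⟨ cong (initV G) d≡D⁻¹ ⟩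
      r (colour G d) (initV G d) ∎
    where
    open ≡-Reasoning
    D : Dart G
    D = dartAt (initV G d) (colour G d)

  r-involutive : ∀ i v → r i (r i v) ≡ v
  r-involutive i v = begin
    r i (termV G D)                    ≡⟨ cong (λ c → r c (termV G D)) (sym colour-D⁻¹) ⟩
    r (colour G (inv G D)) (termV G D) ≡⟨ sym (termV≡r (inv G D)) ⟩
    initV G (inv G (inv G D))          ≡⟨ cong (initV G) (inv-inv G D) ⟩
    initV G D                          ≡⟨ initV-dartAt v i ⟩
    v                                  ∎
    where
    open ≡-Reasoning
    D : Dart G
    D = dartAt v i
    colour-D⁻¹ : colour G (inv G D) ≡ i
    colour-D⁻¹ = trans (colour-inv G D) (colour-dartAt v i)

  automorphism-r : (α : Iso G G) → ∀ i → Homomorphic₁ (Iso.fV α) (r i) (r i)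
  automorphism-r α i v = begin
    Iso.fV α (termV G D)                         ≡⟨ Iso-termV α D ⟩
    termV G (Iso.fD α D)                         ≡⟨ termV≡r (Iso.fD α D) ⟩
    r (colour G (Iso.fD α D)) (initV G (Iso.fD α D)) ≡⟨ cong₂ r colour-αD initV-αD ⟩
    r i (Iso.fV α v)                             ∎
    where
    open ≡-Reasoning
    D : Dart G
    D = dartAt v i
    colour-αD : colour G (Iso.fD α D) ≡ i
    colour-αD = trans (Iso.colour-comm α D) (colour-dartAt v i)
    initV-αD : initV G (Iso.fD α D) ≡ Iso.fV α v
    initV-αD = trans (Iso.init-comm α D) (cong (Iso.fV α) (initV-dartAt v i))

  alternating-r : AlternatingClosed G → ∀ i j → 1 < ∣ toℕ i - toℕ j ∣ →
                  ∀ v → r j (r i (r j (r i v))) ≡ v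
  alternating-r alt i j far v =
    trans (alt i j far d₁ d₂ d₃ d₄ (colour-dartAt _ _) (colour-dartAt _ _) (colour-dartAt _ _) (colour-dartAt _ _)
               (sym (initV-dartAt _ _)) (sym (initV-dartAt _ _)) (sym (initV-dartAt _ _)))
          (initV-dartAt v i)
    where
    d₁ d₂ d₃ d₄ : Dart G
    d₁ = dartAt v i
    d₂ = dartAt (termV G d₁) j
    d₃ = dartAt (termV G d₂) i
    d₄ = dartAt (termV G d₃) j

  walk-preserves : ∀ {c} (P : Vertex G → Set) → (∀ i v → .(¬ i ≡ c) → P v → P (r i v)) →
                   ∀ {v w} → Walk (deleteColour c G) v w → P v → P w
  walk-preserves P P-r [] Pv = Pv
  walk-preserves P P-r (step (kept d d≢c) refl rest) Pv =
    walk-preserves P P-r rest (subst P (sym (termV≡r d)) (P-r (colour G d) (initV G d) d≢c Pv))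

  -- A fixed point of r i may come from a loop (two darts), which fromInvolutions cannot represent.
  iso-fromInvolutions : ∀ {F} {R : Involutions F n} (f : Vertex G → F) (f⁻¹ : F → Vertex G) →
    (∀ v → f⁻¹ (f v) ≡ v) → (∀ Φ → f (f⁻¹ Φ) ≡ Φ) →
    (∀ i → Homomorphic₁ f (r i) (Involutions.r R i)) →
    (∀ i Φ → ¬ Involutions.r R i Φ ≡ Φ) →
    Iso G (fromInvolutions (λ i → i) F R)
  iso-fromInvolutions {F} f f⁻¹ f⁻¹∘f f∘f⁻¹ f-r fixed-point-free = record
    { fV = f ; gV = f⁻¹ ; fD = fD ; gD = gD
    ; gfV = f⁻¹∘f ; fgV = f∘f⁻¹ ; gfD = gD∘fD ; fgD = fD∘gD
    ; init-comm = λ _ → refl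
    ; inv-comm = λ d → cong₂ _,_ (sym (trans (cong f (termV≡r d)) (f-r _ _))) (sym (colour-inv G d))
    ; colour-comm = λ _ → refl
    }
    where
    fD : Dart G → F × Fin n
    fD d = (f (initV G d) , colour G d)

    gD : F × Fin n → Dart G
    gD (Φ , i) = dartAt (f⁻¹ Φ) i

    fD∘gD : ∀ x → fD (gD x) ≡ x
    fD∘gD (Φ , i) = cong₂ _,_ (trans (cong f (initV-dartAt _ i)) (f∘f⁻¹ Φ)) (colour-dartAt _ i)

    gD∘fD : ∀ d → gD (fD d) ≡ d
    gD∘fD d rewrite f⁻¹∘f (initV G d) with dartAt-unique d refl refl
    ... | inj₁ d≡D = sym d≡D
    ... | inj₂ d≡D⁻¹ = ⊥-elim (fixed-point-free (colour G d) (f (initV G d))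
            (trans (sym (f-r _ _)) (cong f (cong (initV G) (sym d≡D⁻¹)))))

pr : ∀ {N} → Fin 2 → PFlag N → PFlag N
pr {N} = Involutions.r (polygonInvolutions N)

rot : ∀ {N} → ℕ → PFlag N → PFlag N
rot = w

pr1-side : ∀ {N} (Φ : PFlag N) → proj₂ (pr1 Φ) ≡ not (proj₂ Φ)
pr1-side {zero}  (() , _)
pr1-side {suc _} (_ , true)  = refl
pr1-side {suc _} (_ , false) = refl

rot-side : ∀ {N} k (Φ : PFlag N) → proj₂ (rot k Φ) ≡ proj₂ Φ
rot-side zero    Φ = refl
rot-side (suc k) Φ = trans (pr1-side (pr0 (rot k Φ))) (trans (not-involutive _) (rot-side k Φ))

flips-side⇒no-fixed-point : ∀ {N} {g : PFlag N → PFlag N} →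
  (∀ Φ → proj₂ (g Φ) ≡ not (proj₂ Φ)) → ∀ Φ → ¬ g Φ ≡ Φ
flips-side⇒no-fixed-point flips Φ gΦ≡Φ = not-¬ refl (trans (sym (cong proj₂ gΦ≡Φ)) (flips Φ))

reflection-flips-side : ∀ {N} j (Φ : PFlag N) → proj₂ (pr0 (rot j Φ)) ≡ not (proj₂ Φ)
reflection-flips-side j Φ = cong not (rot-side j Φ)

pr-no-fixed-point : ∀ {N} i (Φ : PFlag N) → ¬ pr i Φ ≡ Φ
pr-no-fixed-point zero       = flips-side⇒no-fixed-point (λ _ → refl)
pr-no-fixed-point (suc zero) = flips-side⇒no-fixed-point pr1-side

rot-+ : ∀ {N} k l (Φ : PFlag N) → rot (k + l) Φ ≡ rot k (rot l Φ)
rot-+ zero    l Φ = refl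
rot-+ (suc k) l Φ = cong (pr1 ∘ pr0) (rot-+ k l Φ)

rot-pr1-rot : ∀ {N} k (Φ : PFlag N) → rot k (pr1 (rot k Φ)) ≡ pr1 Φ
rot-pr1-rot zero    Φ = refl
rot-pr1-rot {N} (suc k) Φ = begin
  rot (suc k) (pr1 (pr1 (pr0 (rot k Φ))))        ≡⟨ iter-suc′ {N} (pr1 ∘ pr0) k _ ⟩
  rot k (pr1 (pr0 (pr1 (pr1 (pr0 (rot k Φ))))))  ≡⟨ cong (rot k ∘ pr1 ∘ pr0) (pr1-inv (pr0 (rot k Φ))) ⟩
  rot k (pr1 (pr0 (pr0 (rot k Φ))))              ≡⟨ cong (rot k ∘ pr1) (pr0-inv (rot k Φ)) ⟩
  rot k (pr1 (rot k Φ))                          ≡⟨ rot-pr1-rot k Φ ⟩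
  pr1 Φ                                          ∎
  where open ≡-Reasoning

Symmetry : ∀ {N} → (PFlag N → PFlag N) → Set
Symmetry A = ∀ i → Homomorphic₁ A (pr i) (pr i)

Symmetry-rot : ∀ {N} {A : PFlag N → PFlag N} → Symmetry A → ∀ k → Homomorphic₁ A (rot k) (rot k)
Symmetry-rot A-sym zero    Φ = refl
Symmetry-rot A-sym (suc k) Φ =
  trans (A-sym (suc zero) _) (cong pr1 (trans (A-sym zero _) (cong pr0 (Symmetry-rot A-sym k Φ))))

Symmetry-pr0∘rot : ∀ {N} {A : PFlag N → PFlag N} → Symmetry A → ∀ k → Homomorphic₁ A (pr0 ∘ rot k) (pr0 ∘ rot k)
Symmetry-pr0∘rot A-sym k Φ = trans (A-sym zero _) (cong pr0 (Symmetry-rot A-sym k Φ))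

[1+m%n]%n≡[1+m]%n : ∀ m n .{{_ : NonZero n}} → suc (m % n) % n ≡ suc m % n
[1+m%n]%n≡[1+m]%n m n = begin
  (1 + m % n) % n              ≡⟨ %-distribˡ-+ 1 (m % n) n ⟩
  (1 % n + m % n % n) % n      ≡⟨ cong (λ x → (1 % n + x) % n) (m%n%n≡m%n m n) ⟩
  (1 % n + m % n) % n          ≡⟨ %-distribˡ-+ 1 m n ⟨
  (1 + m) % n                  ∎
  where open ≡-Reasoning

module _ {m : ℕ} where

  private
    N : ℕ
    N = suc m

  origin : PFlag N
  origin = (zero , false)

  position : ℕ → Fin N
  position k = fromℕ< (m%n<n k N)

  toℕ-position : ∀ k → toℕ (position k) ≡ k % N
  toℕ-position k = toℕ-fromℕ< (m%n<n k N)

  rot-origin : ∀ k → rot k origin ≡ (position k , false)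
  rot-origin zero    = refl
  rot-origin (suc k) = trans (cong (pr1 ∘ pr0) (rot-origin k)) (cong (_, false) (toℕ-injective (begin
    toℕ (sucMod (position k))     ≡⟨ toℕ-fromℕ< _ ⟩
    suc (toℕ (position k)) % N    ≡⟨ cong (λ x → suc x % N) (toℕ-position k) ⟩
    suc (k % N) % N               ≡⟨ [1+m%n]%n≡[1+m]%n k N ⟩
    suc k % N                     ≡⟨ toℕ-position (suc k) ⟨
    toℕ (position (suc k))        ∎)))
    where open ≡-Reasoning

  rot-origin-injective : ∀ k l → rot k origin ≡ rot l origin → k % N ≡ l % N
  rot-origin-injective k l e = begin
    k % N                    ≡⟨ toℕ-position k ⟨
    toℕ (position k)         ≡⟨ cong (toℕ ∘ proj₁) (trans (sym (rot-origin k)) (trans e (rot-origin l))) ⟩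
    toℕ (position l)         ≡⟨ toℕ-position l ⟩
    l % N                    ∎
    where open ≡-Reasoning

  rot-origin-cong : ∀ k l → k % N ≡ l % N → rot k origin ≡ rot l origin
  rot-origin-cong k l e = begin
    rot k origin             ≡⟨ rot-origin k ⟩
    (position k , false)     ≡⟨ cong (_, false) (toℕ-injective (trans (toℕ-position k) (trans e (sym (toℕ-position l))))) ⟩
    (position l , false)     ≡⟨ rot-origin l ⟨
    rot l origin             ∎
    where open ≡-Reasoning

  rot-origin≡origin⇒∣ : ∀ k → rot k origin ≡ origin → N ∣ k
  rot-origin≡origin⇒∣ k e = m%n≡0⇒n∣m k N (rot-origin-injective k 0 e)

  unrotated-flag : ∀ (J : Fin N) → (J , false) ≡ rot (toℕ J) origin
  unrotated-flag J = sym (trans (rot-origin (toℕ J))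
    (cong (_, false) (toℕ-injective (trans (toℕ-position (toℕ J)) (m<n⇒m%n≡m (toℕ<n J))))))

  -- the orbit of origin under the group generated by pr1 and rot s
  Orbit : ℕ → PFlag N → Set
  Orbit s Φ = Σ ℕ λ c → Φ ≡ rot (c * s) origin ⊎ Φ ≡ pr1 (rot (c * s) origin)

  orbit-origin : ∀ {s} → Orbit s origin
  orbit-origin = 0 , inj₁ refl

  orbit-pr1 : ∀ {s Φ} → Orbit s Φ → Orbit s (pr1 Φ)
  orbit-pr1 (c , inj₁ e) = c , inj₂ (cong pr1 e)
  orbit-pr1 (c , inj₂ e) = c , inj₁ (trans (cong pr1 e) (pr1-inv _))

  orbit-rot : ∀ {s Φ} → Orbit s Φ → Orbit s (rot s Φ)
  orbit-rot {s} (c , inj₁ e) = suc c , inj₁ (trans (cong (rot s) e) (sym (rot-+ s (c * s) origin)))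
  orbit-rot {s} {Φ} (c , inj₂ e) = c + m , inj₂ (begin
    rot s Φ                                         ≡⟨ cong (rot s) e ⟩
    rot s (pr1 (rot (c * s) origin))                ≡⟨ cong (rot s ∘ pr1) (rot-origin-cong (c * s) (s + (c + m) * s) one-turn-more) ⟩
    rot s (pr1 (rot (s + (c + m) * s) origin))      ≡⟨ cong (rot s ∘ pr1) (rot-+ s ((c + m) * s) origin) ⟩
    rot s (pr1 (rot s (rot ((c + m) * s) origin)))  ≡⟨ rot-pr1-rot s _ ⟩
    pr1 (rot ((c + m) * s) origin)                  ∎)
    where
    open ≡-Reasoning
    shift : ∀ c m s → s + (c + m) * s ≡ c * s + s * suc m
    shift = solve-∀
    -- a full turn s * N added to c * s makes room to peel off one rot s
    one-turn-more : (c * s) % N ≡ (s + (c + m) * s) % N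
    one-turn-more = sym (trans (cong (_% N) (shift c m s)) ([m+kn]%n≡m%n (c * s) s N))

  orbit-rot* : ∀ {s Φ} c → Orbit s Φ → Orbit s (rot (c * s) Φ)
  orbit-rot*         zero    o = o
  orbit-rot* {s} {Φ} (suc c) o = subst (Orbit s) (sym (rot-+ s (c * s) Φ)) (orbit-rot (orbit-rot* c o))

  pr0-origin∉Orbit : ∀ {d s} → 2 ≤ d → d ∣ s → d ∣ N → ¬ Orbit s (pr0 origin)
  pr0-origin∉Orbit {s = s} _   _   _   (c , inj₁ e) with trans (cong proj₂ e) (rot-side (c * s) origin)
  ... | ()
  pr0-origin∉Orbit {d} {s} 2≤d d∣s d∣N (c , inj₂ e) = <-irrefl refl (subst (2 ≤_) (∣1⇒≡1 d∣1) 2≤d)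
    where
    1≡cs : 1 % N ≡ (c * s) % N
    1≡cs = rot-origin-injective 1 (c * s) (trans (cong pr1 e) (pr1-inv _))
    d∣1 : d ∣ 1
    d∣1 = ∣n∣m%n⇒∣m d∣N (subst (d ∣_) (sym 1≡cs) (%-presˡ-∣ (∣n⇒∣m*n c d∣s) d∣N))

n∣m+m⇒m≡0⊎m+m≡n : ∀ {m n} → m < n → n ∣ m + m → m ≡ 0 ⊎ m + m ≡ n
n∣m+m⇒m≡0⊎m+m≡n {m}     _   (divides zero          e) = inj₁ (m+n≡0⇒m≡0 m e)
n∣m+m⇒m≡0⊎m+m≡n {n = n} _   (divides (suc zero)    e) = inj₂ (trans e (+-identityʳ n))
n∣m+m⇒m≡0⊎m+m≡n {n = n} m<n (divides (suc (suc q)) e) =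
  ⊥-elim (<-irrefl e (<-≤-trans (+-mono-< m<n m<n) (+-monoʳ-≤ n (m≤m+n n (q * n)))))

2∣n⊎2∣1+n : ∀ n → 2 ∣ n ⊎ 2 ∣ suc n
2∣n⊎2∣1+n zero = inj₁ (2 ∣0)
2∣n⊎2∣1+n (suc n) with 2∣n⊎2∣1+n n
... | inj₁ 2∣n   = inj₂ (∣m∣n⇒∣m+n ∣-refl 2∣n)
... | inj₂ 2∣1+n = inj₁ 2∣1+n

2∣n+n : ∀ n → 2 ∣ n + n
2∣n+n n = divides n (sym (trans (*-suc n 1) (cong (n +_) (*-identityʳ n))))

two : Fin 3
two = suc (suc zero)

module Coordinates (X : ColouredGraph 3) (one : OneEdgeOfEachColour X) {N : ℕ}
                   (φ : Iso (deleteColour two X) (polygon N)) where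

  open Neighbours X one

  ψ : Vertex X → PFlag N
  ψ = Iso.fV φ

  ψ⁻¹ : PFlag N → Vertex X
  ψ⁻¹ = Iso.gV φ

  ψ-r : ∀ i → Homomorphic₁ ψ (r (inject₁ i)) (pr i)
  ψ-r i v = begin
    ψ (termV X D)                     ≡⟨ Iso-termV φ (kept D D≢two) ⟩
    termV (polygon N) (Iso.fD φ (kept D D≢two))  ≡⟨ cong₂ pr colour≡i initV≡ψv ⟩
    pr i (ψ v)                        ∎
    where
    open ≡-Reasoning
    D : Dart X
    D = dartAt v (inject₁ i)
    D≢two : ¬ colour X D ≡ two
    D≢two e = fromℕ≢inject₁ (trans (sym e) (colour-dartAt v _))
    colour≡i : proj₂ (Iso.fD φ (kept D D≢two)) ≡ i
    colour≡i = inject₁-injective (trans (Iso.colour-comm φ _) (colour-dartAt v _))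
    initV≡ψv : proj₁ (Iso.fD φ (kept D D≢two)) ≡ ψ v
    initV≡ψv = trans (Iso.init-comm φ _) (cong ψ (initV-dartAt v _))

  ψ⁻¹-pr : ∀ i → Homomorphic₁ ψ⁻¹ (pr i) (r (inject₁ i))
  ψ⁻¹-pr i Φ = begin
    ψ⁻¹ (pr i Φ)                      ≡⟨ cong (ψ⁻¹ ∘ pr i) (Iso.fgV φ Φ) ⟨
    ψ⁻¹ (pr i (ψ (ψ⁻¹ Φ)))            ≡⟨ cong ψ⁻¹ (ψ-r i (ψ⁻¹ Φ)) ⟨
    ψ⁻¹ (ψ (r (inject₁ i) (ψ⁻¹ Φ)))   ≡⟨ Iso.gfV φ _ ⟩
    r (inject₁ i) (ψ⁻¹ Φ)             ∎
    where open ≡-Reasoning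

  module _ (g : PFlag N → PFlag N) (ψ-r₂ : Homomorphic₁ ψ (r two) g) where

    involutive-in-coordinates : ∀ Φ → g (g Φ) ≡ Φ
    involutive-in-coordinates Φ = begin
      g (g Φ)                 ≡⟨ cong (g ∘ g) (Iso.fgV φ Φ) ⟨
      g (g (ψ x))             ≡⟨ cong g (ψ-r₂ x) ⟨
      g (ψ (r two x))         ≡⟨ ψ-r₂ _ ⟨
      ψ (r two (r two x))     ≡⟨ cong ψ (r-involutive two x) ⟩
      ψ x                     ≡⟨ Iso.fgV φ Φ ⟩
      Φ                       ∎
      where
      open ≡-Reasoning
      x : Vertex X
      x = ψ⁻¹ Φ

    alternating-in-coordinates : AlternatingClosed X → ∀ Φ → g (pr0 (g (pr0 Φ))) ≡ Φ
    alternating-in-coordinates alt Φ = begin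
      g (pr0 (g (pr0 Φ)))                  ≡⟨ cong (g ∘ pr0 ∘ g ∘ pr0) (Iso.fgV φ Φ) ⟨
      g (pr0 (g (pr0 (ψ x))))              ≡⟨ cong (g ∘ pr0 ∘ g) (ψ-r zero x) ⟨
      g (pr0 (g (ψ (r zero x))))           ≡⟨ cong (g ∘ pr0) (ψ-r₂ _) ⟨
      g (pr0 (ψ (r two (r zero x))))       ≡⟨ cong g (ψ-r zero _) ⟨
      g (ψ (r zero (r two (r zero x))))    ≡⟨ ψ-r₂ _ ⟨
      ψ (r two (r zero (r two (r zero x))))  ≡⟨ cong ψ (alternating-r alt zero two (s≤s (s≤s z≤n)) x) ⟩
      ψ x                                  ≡⟨ Iso.fgV φ Φ ⟩
      Φ                                    ∎
      where
      open ≡-Reasoning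
      x : Vertex X
      x = ψ⁻¹ Φ

    connected₀⇒transitive : Connected (deleteColour zero X) → (S : PFlag N → Set) →
      (∀ Φ → S Φ → S (pr1 Φ)) → (∀ Φ → S Φ → S (g Φ)) → ∀ Φ Ψ → S Φ → S Ψ
    connected₀⇒transitive conn₀ S S-pr1 S-g Φ Ψ SΦ =
      subst S (Iso.fgV φ Ψ) (walk-preserves (S ∘ ψ) S-r (conn₀ (ψ⁻¹ Φ) (ψ⁻¹ Ψ)) (subst S (sym (Iso.fgV φ Φ)) SΦ))
      where
      S-r : ∀ i v → .(¬ i ≡ zero) → S (ψ v) → S (ψ (r i v))
      S-r zero             v i≢0 _  = Irrelevant.⊥-elim (i≢0 refl)
      S-r (suc zero)       v _   Sv = subst S (sym (ψ-r (suc zero) v)) (S-pr1 _ Sv)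
      S-r (suc (suc zero)) v _   Sv = subst S (sym (ψ-r₂ v)) (S-g _ Sv)

    iso-threeFrom : (g-inv : ∀ Φ → g (g Φ) ≡ Φ) → (∀ Φ → ¬ g Φ ≡ Φ) → Iso X (threeFrom N g g-inv)
    iso-threeFrom g-inv g-no-fixed-point = iso-fromInvolutions ψ ψ⁻¹ (Iso.gfV φ) (Iso.fgV φ)
      (λ { zero → ψ-r zero ; (suc zero) → ψ-r (suc zero) ; (suc (suc zero)) → ψ-r₂ })
      (λ { zero → pr-no-fixed-point zero ; (suc zero) → pr-no-fixed-point (suc zero)
         ; (suc (suc zero)) → g-no-fixed-point })

module _ (X : ColouredGraph 3) (one : OneEdgeOfEachColour X) where

  open Neighbours X one

  iso-family2 : ∀ {N} k → N ≡ 4 * k → (φ : Iso (deleteColour two X) (polygon N)) →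
                Homomorphic₁ (Iso.fV φ) (r two) (reflect (2 * k)) → Iso X (family2 k)
  iso-family2 k refl φ ψ-r₂ = Coordinates.iso-threeFrom X one φ _ ψ-r₂ (reflect-inv (2 * k))
    (flips-side⇒no-fixed-point (reflection-flips-side (2 * k)))

  iso-Xs : ∀ {N} → N ≡ 2 → (φ : Iso (deleteColour two X) (polygon N)) →
           Homomorphic₁ (Iso.fV φ) (r two) (rot 1) → Iso X Xs
  iso-Xs refl φ ψ-r₂ = Coordinates.iso-threeFrom X one φ (rot 1) ψ-r₂ xs-inv rot-1-no-fixed-point
    where
    rot-1-no-fixed-point : ∀ Φ → ¬ rot 1 Φ ≡ Φ
    rot-1-no-fixed-point (zero     , true)  ()
    rot-1-no-fixed-point (zero     , false) ()
    rot-1-no-fixed-point (suc zero , true)  ()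
    rot-1-no-fixed-point (suc zero , false) ()

module Classification (X : ColouredGraph 3) (one : OneEdgeOfEachColour X) (alt : AlternatingClosed X)
                      (reg : IsRegular X) (conn₀ : Connected (deleteColour zero X))
                      {m : ℕ} (φ : Iso (deleteColour two X) (polygon (suc (suc m)))) where

  open Neighbours X one
  open Coordinates X one φ

  private
    N : ℕ
    N = suc (suc m)

  conjugate : Iso X X → PFlag N → PFlag N
  conjugate α = ψ ∘ Iso.fV α ∘ ψ⁻¹

  conjugate-symmetry : ∀ α → Symmetry (conjugate α)
  conjugate-symmetry α i Φ = begin
    ψ (Iso.fV α (ψ⁻¹ (pr i Φ)))            ≡⟨ cong (ψ ∘ Iso.fV α) (ψ⁻¹-pr i Φ) ⟩
    ψ (Iso.fV α (r (inject₁ i) (ψ⁻¹ Φ)))   ≡⟨ cong ψ (automorphism-r α (inject₁ i) _) ⟩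
    ψ (r (inject₁ i) (Iso.fV α (ψ⁻¹ Φ)))   ≡⟨ ψ-r i _ ⟩
    pr i (conjugate α Φ)                   ∎
    where open ≡-Reasoning

  r₂-from-origin : ∀ {g} → (∀ {A} → Symmetry A → Homomorphic₁ A g g) →
                   ψ (r two (ψ⁻¹ origin)) ≡ g origin → Homomorphic₁ ψ (r two) g
  r₂-from-origin {g} g-central e x with reg (ψ⁻¹ origin) x
  ... | α , refl = begin
    ψ (r two (Iso.fV α x₀))        ≡⟨ cong ψ (automorphism-r α two x₀) ⟨
    ψ (Iso.fV α (r two x₀))        ≡⟨ cong (ψ ∘ Iso.fV α) (Iso.gfV φ _) ⟨
    conjugate α (ψ (r two x₀))     ≡⟨ cong (conjugate α) e ⟩
    conjugate α (g origin)         ≡⟨ g-central (conjugate-symmetry α) origin ⟩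
    g (conjugate α origin)         ∎
    where
    open ≡-Reasoning
    x₀ : Vertex X
    x₀ = ψ⁻¹ origin

  data R₂Shape : Set where
    rotation   : ∀ {j} → j < N → Homomorphic₁ ψ (r two) (rot j) → R₂Shape
    reflection : ∀ {j} → j < N → Homomorphic₁ ψ (r two) (pr0 ∘ rot j) → R₂Shape

  r₂-shape : R₂Shape
  r₂-shape with ψ (r two (ψ⁻¹ origin)) in e
  ... | J , false = rotation (toℕ<n J)
        (r₂-from-origin (λ A-sym → Symmetry-rot A-sym (toℕ J)) (trans e (unrotated-flag J)))
  ... | J , true  = reflection (toℕ<n J)
        (r₂-from-origin (λ A-sym → Symmetry-pr0∘rot A-sym (toℕ J))
                        (trans e (cong pr0 (unrotated-flag J))))

  rotation-period : ∀ j → Homomorphic₁ ψ (r two) (rot j) → N ∣ j + j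
  rotation-period j ψ-r₂ =
    rot-origin≡origin⇒∣ (j + j) (trans (rot-+ j j origin) (involutive-in-coordinates (rot j) ψ-r₂ origin))

  reflection-period : ∀ j → Homomorphic₁ ψ (r two) (pr0 ∘ rot j) → N ∣ j + j
  reflection-period j ψ-r₂ = rot-origin≡origin⇒∣ (j + j) (begin
    rot (j + j) origin                          ≡⟨ rot-+ j j origin ⟩
    rot j (rot j origin)                        ≡⟨ cong (rot j) (pr0-inv _) ⟨
    rot j (pr0 (pr0 (rot j origin)))            ≡⟨ pr0-inv _ ⟨
    pr0 (pr0 (rot j (pr0 (pr0 (rot j origin))))) ≡⟨ cong pr0 (alternating-in-coordinates (pr0 ∘ rot j) ψ-r₂ alt (pr0 origin)) ⟩
    origin                                      ∎)
    where open ≡-Reasoning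

  no-invariant-orbit : ∀ g {s d} → Homomorphic₁ ψ (r two) g → (∀ Φ → Orbit s Φ → Orbit s (g Φ)) →
                       2 ≤ d → d ∣ s → d ∣ N → ⊥
  no-invariant-orbit g ψ-r₂ g-orbit 2≤d d∣s d∣N = pr0-origin∉Orbit 2≤d d∣s d∣N
    (connected₀⇒transitive g ψ-r₂ conn₀ (Orbit _) (λ _ → orbit-pr1) g-orbit origin (pr0 origin) orbit-origin)

  rotation⇒Xs : ∀ {j} → j < N → Homomorphic₁ ψ (r two) (rot j) → Iso X Xs
  rotation⇒Xs {j} j<N ψ-r₂ with n∣m+m⇒m≡0⊎m+m≡n j<N (rotation-period j ψ-r₂)
  rotation⇒Xs {zero} _ ψ-r₂ | _ =
    ⊥-elim (no-invariant-orbit (rot 0) ψ-r₂ (λ _ → orbit-rot {s = 0}) (s≤s (s≤s z≤n)) (N ∣0) ∣-refl)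
  rotation⇒Xs {suc _} _ _ | inj₁ ()
  rotation⇒Xs {1} _ ψ-r₂ | inj₂ 2≡N = iso-Xs X one (sym 2≡N) φ ψ-r₂
  rotation⇒Xs {j@(suc (suc _))} _ ψ-r₂ | inj₂ j+j≡N =
    ⊥-elim (no-invariant-orbit (rot j) ψ-r₂ (λ _ → orbit-rot {s = j}) (s≤s (s≤s z≤n)) ∣-refl
                               (subst (j ∣_) j+j≡N (∣m∣n⇒∣m+n ∣-refl ∣-refl)))

  reflection⇒family : ∀ {j} → j < N → Homomorphic₁ ψ (r two) (pr0 ∘ rot j) →
                      Iso X (family1 N) ⊎ Σ ℕ λ k → 1 ≤ k × Iso X (family2 k)
  reflection⇒family {j} j<N ψ-r₂ with n∣m+m⇒m≡0⊎m+m≡n j<N (reflection-period j ψ-r₂) | 2∣n⊎2∣1+n j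
  ... | inj₁ refl | _ = inj₁ (iso-threeFrom pr0 ψ-r₂ pr0-inv (pr-no-fixed-point zero))
  ... | inj₂ () | inj₁ (divides zero refl)
  ... | inj₂ j+j≡N | inj₁ (divides k@(suc _) refl) =
    inj₂ (k , s≤s z≤n , iso-family2 X one k (trans (sym j+j≡N) (four k)) φ
                          (subst (λ i → Homomorphic₁ ψ (r two) (pr0 ∘ rot i)) (*-comm k 2) ψ-r₂))
    where
    four : ∀ k → k * 2 + k * 2 ≡ 4 * k
    four = solve-∀
  ... | inj₂ j+j≡N | inj₂ (divides c 1+j≡c*2) =
    ⊥-elim (no-invariant-orbit (pr0 ∘ rot j) ψ-r₂ orbit-reflection (s≤s (s≤s z≤n)) ∣-refl (subst (2 ∣_) j+j≡N (2∣n+n j)))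
    where
    orbit-reflection : ∀ Φ → Orbit 2 Φ → Orbit 2 (pr0 (rot j Φ))
    orbit-reflection Φ o = subst (Orbit 2) (pr1-inv (pr0 (rot j Φ)))
      (orbit-pr1 (subst (λ i → Orbit 2 (rot i Φ)) (sym 1+j≡c*2) (orbit-rot* c o)))

proposition5p1 : (X : ColouredGraph 3) → IsPremaniplex X → IsRegular X →
    (Σ ℕ λ n → 2 ≤ n × Iso (deleteColour (suc (suc zero)) X) (polygon n)) →
    Connected (deleteColour zero X) →
    (Σ ℕ λ n → 2 ≤ n × Iso X (family1 n))
      ⊎ ((Σ ℕ λ k → 1 ≤ k × Iso X (family2 k))
      ⊎ Iso X Xs)
proposition5p1 X (_ , one , alt) reg (_ , 2≤N@(s≤s (s≤s _)) , φ) conn₀ =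
  case r₂-shape of λ where
    (rotation j<N ψ-r₂)   → inj₂ (inj₂ (rotation⇒Xs j<N ψ-r₂))
    (reflection j<N ψ-r₂) → case reflection⇒family j<N ψ-r₂ of λ where
      (inj₁ X≅family1) → inj₁ (_ , 2≤N , X≅family1)
      (inj₂ X≅family2) → inj₂ (inj₁ X≅family2)
  where open Classification X one alt reg conn₀ φ
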